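{- Let $\pi$ be a finite projective plane of order $q^2$ with a unitary polarity $\perp$, and let $S$ be a set of non-absolute points of $\pi$ inducing a triangle-free subgraph of the unitary polarity graph $\mathrm{UP}(q^2)$, with $|S| = (q^4+q)/2$. Then for every point $x$ of $\pi$, \[|x^\perp \cap S| = \begin{cases} \frac{q^2-q}{2} & \text{if } x \in S,\\ \frac{q^2+q}{2} & \text{if } x \notin S.\end{cases}\]
   Context: A polarity $\perp$ is an involutory incidence-preserving bijection between points and lines; $x^\perp$ is the polar line of $x$; $x$ is absolute if $x \in x^\perp$. A unitary polarity of a plane of order $q^2$ has exactly $q^3+1$ absolute points. $\mathrm{UP}(q^2)$ has the points of $\pi$ as vertices, $x,y$ adjacent iff $x \in y^\perp$. A triangle is a set of three distinct pairwise adjacent vertices. -}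

module Defs where

open import Data.Nat using (ℕ; zero; suc; _+_; _*_; _∸_; _^_)
open import Data.Bool using (Bool; true; false; T; if_then_else_)
open import Data.Fin using (Fin; zero; suc)
open import Data.Product using (Σ; _×_; _,_; ∃; ∃-syntax)
open import Relation.Nullary using (¬_)
open import Relation.Binary.PropositionalEquality using (_≡_; _≢_)

count : {m : ℕ} → (Fin m → Bool) → ℕ
count {zero}  p = 0
count {suc m} p = (if p zero then 1 else 0) + count (λ i → p (suc i))

record ProjectivePlane (n : ℕ) : Set where
  field
    np nl : ℕ
    inc : Fin np → Fin nl → Bool
    join : ∀ x y → x ≢ y → ∃[ ℓ ] (T (inc x ℓ) × T (inc y ℓ))
    join-unique : ∀ x y ℓ m → x ≢ y →
      T (inc x ℓ) → T (inc y ℓ) → T (inc x m) → T (inc y m) → ℓ ≡ m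
    meet : ∀ ℓ m → ℓ ≢ m → ∃[ x ] (T (inc x ℓ) × T (inc x m))
    meet-unique : ∀ ℓ m x y → ℓ ≢ m →
      T (inc x ℓ) → T (inc x m) → T (inc y ℓ) → T (inc y m) → x ≡ y
    quadrangle : Σ (Fin 4 → Fin np) λ f →
      ((i j : Fin 4) → i ≢ j → f i ≢ f j) ×
      ((i j k : Fin 4) → i ≢ j → j ≢ k → i ≢ k →
        ¬ (∃[ ℓ ] (T (inc (f i) ℓ) × T (inc (f j) ℓ) × T (inc (f k) ℓ))))
    line-size : ∀ ℓ → count (λ x → inc x ℓ) ≡ suc n

module _ {n : ℕ} (Π : ProjectivePlane n) where
  open ProjectivePlane Π

  -- A polarity: a bijection points ↔ lines (pol, with inverse pol⁻),
  -- involutory (pol⁻ is the action on lines), incidence preserving.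
  record Polarity : Set where
    field
      pol  : Fin np → Fin nl
      pol⁻ : Fin nl → Fin np
      pol⁻-pol : ∀ x → pol⁻ (pol x) ≡ x
      pol-pol⁻ : ∀ ℓ → pol (pol⁻ ℓ) ≡ ℓ
      preserves : ∀ x ℓ → inc x ℓ ≡ inc (pol⁻ ℓ) (pol x)

  module _ (⊥ : Polarity) where
    open Polarity ⊥

    absolute : Fin np → Bool
    absolute x = inc x (pol x)

    Adjacent : Fin np → Fin np → Set
    Adjacent x y = x ≢ y × T (inc x (pol y))

    TriangleFree : (Fin np → Bool) → Set
    TriangleFree S = ∀ x y z → T (S x) → T (S y) → T (S z) →
      ¬ (Adjacent x y × Adjacent y z × Adjacent x z)

IsUnitary : (q : ℕ) (Π : ProjectivePlane (q ^ 2)) → Polarity Π → Set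
IsUnitary q Π ⊥ = count (absolute Π ⊥) ≡ q ^ 3 + 1

Point : {n : ℕ} → ProjectivePlane n → Set
Point Π = Fin (ProjectivePlane.np Π)

module Submission where

-- Let M be the 0/1 matrix with M x y = 1 iff x ∈ y^⊥. It is symmetric and M² = J + q² I, so for every
-- vector g with zero sum ‖(M + q) g‖² = 2q ⟨g, (M + q) g⟩. Applied to the centred indicator of a point
-- set B this gives a Hoffman-type inequality relating |B| to Σ_{x ∈ B} |x^⊥ ∩ B|, and equality holds
-- exactly when |x^⊥ ∩ B| + q [x ∈ B] is the same for all points x.
-- The q³ + 1 absolute points attain equality (an absolute point is the only absolute point on its
-- polar), so every non-absolute polar line carries q + 1 absolute points. For a triangle-free set S of
-- non-absolute points and x ∈ S, each y ∈ x^⊥ ∩ S determines the point x^⊥ ∩ y^⊥, which is neither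
-- absolute nor in S, and distinct y give distinct points; hence 2 |x^⊥ ∩ S| ≤ q² - q. When
-- |S| = (q⁴ + q)/2 this makes S attain equality too, and the equality condition is the claimed count.

open import Defs
open import Data.Nat as ℕ using (ℕ; zero; suc)
import Data.Nat.Properties as ℕP
open import Data.Integer using (ℤ; +_; 0ℤ; 1ℤ; -[1+_]; +≤+; nonNegative)
import Data.Integer.Properties as ℤP
open import Data.Integer.Tactic.RingSolver using (solve-∀)
open import Data.Fin using (Fin; zero; suc)
open import Data.Fin.Properties using (_≟_; nonZeroIndex)
open import Data.Bool using (Bool; true; false; T; _∧_; not; if_then_else_)
open import Data.Bool.Properties using (T-∧; ∧-idem; ∧-comm)
open import Data.Product using (_×_; _,_; proj₁; proj₂)
open import Data.Sum using (inj₁; inj₂)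
open import Data.Unit using (tt)
open import Function using (_∘_; Equivalence)
open import Relation.Nullary using (¬_; does; yes; no; contradiction)
open import Relation.Binary.PropositionalEquality
open import Algebra.Properties.Semiring.Sum ℤP.+-*-semiring
  using (sum; sum-syntax; sum-cong-≗; sum-replicate-zero; ∑-distrib-+; ∑-comm; *-distribˡ-sum; *-distribʳ-sum)

∧-intro : ∀ {a b} → T a → T b → T (a ∧ b)
∧-intro ta tb = Equivalence.from T-∧ (ta , tb)

∧-elim : ∀ {a b} → T (a ∧ b) → T a × T b
∧-elim = Equivalence.to T-∧

¬T⇒T-not : ∀ {b} → ¬ T b → T (not b)
¬T⇒T-not {true}  ¬b = ¬b tt
¬T⇒T-not {false} _  = tt

T-not⇒¬T : ∀ {b} → T (not b) → ¬ T b
T-not⇒¬T {true}  ()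

-- Integer arithmetic is opened only in this block: lemma2 below uses the operators of ℕ.
module _ where
  open import Data.Integer using (_+_; _*_; _-_; -_; _≤_; _^_; _⊖_)

  χ : Bool → ℤ
  χ true  = 1ℤ
  χ false = 0ℤ

  χ-∧ : ∀ a b → χ a * χ b ≡ χ (a ∧ b)
  χ-∧ true  b = ℤP.*-identityˡ (χ b)
  χ-∧ false b = refl

  χ-nonneg : ∀ b → 0ℤ ≤ χ b
  χ-nonneg true  = +≤+ ℕ.z≤n
  χ-nonneg false = ℤP.≤-refl

  χ-mono : ∀ {a b} → (T a → T b) → χ a ≤ χ b
  χ-mono {true}  {true}  _ = ℤP.≤-refl
  χ-mono {true}  {false} h = contradiction (h tt) λ ()
  χ-mono {false} {b}     _ = χ-nonneg b

  count-as-sum : ∀ {n} (p : Fin n → Bool) → + count p ≡ ∑[ i < n ] χ (p i)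
  count-as-sum {zero}  p = refl
  count-as-sum {suc n} p =
    trans (ℤP.pos-+ (if p zero then 1 else 0) (count (p ∘ suc)))
          (cong₂ _+_ (pos-if (p zero)) (count-as-sum (p ∘ suc)))
    where
    pos-if : ∀ b → + (if b then 1 else 0) ≡ χ b
    pos-if true  = refl
    pos-if false = refl

  χ-T : ∀ {b} → T b → χ b ≡ 1ℤ
  χ-T {true} _ = refl

  χ-¬T : ∀ {b} → ¬ T b → χ b ≡ 0ℤ
  χ-¬T {true}  ¬b = contradiction tt ¬b
  χ-¬T {false} _  = refl

  δ : ∀ {n} → Fin n → Fin n → ℤ
  δ y z = χ (does (y ≟ z))

  sum-const : ∀ n c → ∑[ i < n ] c ≡ + n * c
  sum-const zero    c = sym (ℤP.*-zeroˡ c)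
  sum-const (suc n) c = begin
    c + ∑[ i < n ] c   ≡⟨ cong (λ s → c + s) (sum-const n c) ⟩
    c + + n * c        ≡⟨ cong (_+ + n * c) (sym (ℤP.*-identityˡ c)) ⟩
    1ℤ * c + + n * c   ≡⟨ sym (ℤP.*-distribʳ-+ c 1ℤ (+ n)) ⟩
    + suc n * c        ∎
    where open ≡-Reasoning

  sum-scale : ∀ {n} c (f : Fin n → ℤ) → ∑[ i < n ] (c * f i) ≡ c * sum f
  sum-scale c f = sym (*-distribˡ-sum c f)

  sum-affine : ∀ {n} α β γ δ (f g h : Fin n → ℤ) →
    ∑[ i < n ] (α * f i + β * g i + γ * h i + δ) ≡ α * sum f + β * sum g + γ * sum h + + n * δ
  sum-affine {n} α β γ δ f g h = begin
    ∑[ i < n ] (α * f i + β * g i + γ * h i + δ)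
      ≡⟨ ∑-distrib-+ (λ i → α * f i + β * g i + γ * h i) (λ _ → δ) ⟩
    ∑[ i < n ] (α * f i + β * g i + γ * h i) + ∑[ i < n ] δ
      ≡⟨ cong₂ _+_ (∑-distrib-+ (λ i → α * f i + β * g i) (λ i → γ * h i)) (sum-const n δ) ⟩
    ∑[ i < n ] (α * f i + β * g i) + ∑[ i < n ] (γ * h i) + + n * δ
      ≡⟨ cong (λ s → s + ∑[ i < n ] (γ * h i) + + n * δ) (∑-distrib-+ (λ i → α * f i) (λ i → β * g i)) ⟩
    ∑[ i < n ] (α * f i) + ∑[ i < n ] (β * g i) + ∑[ i < n ] (γ * h i) + + n * δ
      ≡⟨ cong (λ s → s + + n * δ) (cong₂ _+_ (cong₂ _+_ (sum-scale α f) (sum-scale β g)) (sum-scale γ h)) ⟩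
    α * sum f + β * sum g + γ * sum h + + n * δ
      ∎
    where open ≡-Reasoning

  sum-mono : ∀ {n} {f g : Fin n → ℤ} → (∀ i → f i ≤ g i) → sum f ≤ sum g
  sum-mono {zero}  _   = ℤP.≤-refl
  sum-mono {suc n} f≤g = ℤP.+-mono-≤ (f≤g zero) (sum-mono (f≤g ∘ suc))

  sum-δ : ∀ {n} (y : Fin n) (f : Fin n → ℤ) → ∑[ z < n ] (f z * δ y z) ≡ f y
  sum-δ {suc n} zero    f = begin
    f zero * 1ℤ + ∑[ z < n ] (f (suc z) * 0ℤ)  ≡⟨ cong₂ _+_ (ℤP.*-identityʳ (f zero)) (sum-cong-≗ (λ z → ℤP.*-zeroʳ (f (suc z)))) ⟩
    f zero + ∑[ z < n ] 0ℤ                   ≡⟨ cong (λ s → f zero + s) (sum-replicate-zero n) ⟩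
    f zero + 0ℤ                              ≡⟨ ℤP.+-identityʳ (f zero) ⟩
    f zero                                   ∎
    where open ≡-Reasoning
  sum-δ {suc n} (suc y) f =
    trans (cong₂ _+_ (ℤP.*-zeroʳ (f zero)) (sum-δ y (f ∘ suc))) (ℤP.+-identityˡ (f (suc y)))

  sum-χ-unique : ∀ {n} (p : Fin n → Bool) (w : Fin n) →
    T (p w) → (∀ v → T (p v) → v ≡ w) → ∑[ i < n ] χ (p i) ≡ 1ℤ
  sum-χ-unique p w pw unique =
    trans (sum-cong-≗ χ-p≡δ) (sum-δ w (λ _ → 1ℤ))
    where
    χ-p≡δ : ∀ i → χ (p i) ≡ 1ℤ * δ w i
    χ-p≡δ i with w ≟ i | p i in pi
    ... | yes refl | true  = refl
    ... | yes refl | false = contradiction (subst T pi pw) λ ()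
    ... | no  w≢i  | true  = contradiction (sym (unique i (subst T (sym pi) tt))) w≢i
    ... | no  w≢i  | false = refl

  square-nonneg : ∀ i → 0ℤ ≤ i * i
  square-nonneg (+ n)    = subst (0ℤ ≤_) (ℤP.pos-* n n) (+≤+ ℕ.z≤n)
  square-nonneg -[1+ n ] = +≤+ ℕ.z≤n

  sum-squares-≤0⇒≡0 : ∀ {n} (f : Fin n → ℤ) → ∑[ i < n ] (f i * f i) ≤ 0ℤ → ∀ i → f i ≡ 0ℤ
  sum-squares-≤0⇒≡0 {suc n} f ≤0 zero    = square≡0 (f zero) (ℤP.≤-antisym head≤0 (square-nonneg (f zero)))
    where
    tail-nonneg : 0ℤ ≤ ∑[ j < n ] (f (suc j) * f (suc j))
    tail-nonneg = subst (_≤ ∑[ j < n ] (f (suc j) * f (suc j))) (sum-replicate-zero n) (sum-mono (λ j → square-nonneg (f (suc j))))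
    head≤0 : f zero * f zero ≤ 0ℤ
    head≤0 = ℤP.≤-trans (ℤP.i≤i+j _ _ {{nonNegative tail-nonneg}}) ≤0
    square≡0 : ∀ a → a * a ≡ 0ℤ → a ≡ 0ℤ
    square≡0 a aa≡0 with ℤP.i*j≡0⇒i≡0∨j≡0 a aa≡0
    ... | inj₁ a≡0 = a≡0
    ... | inj₂ a≡0 = a≡0
  sum-squares-≤0⇒≡0 {suc n} f ≤0 (suc i) = sum-squares-≤0⇒≡0 (f ∘ suc) tail≤0 i
    where
    tail≤0 : ∑[ j < n ] (f (suc j) * f (suc j)) ≤ 0ℤ
    tail≤0 = ℤP.≤-trans (ℤP.i≤j+i _ _ {{nonNegative (square-nonneg (f zero))}}) ≤0

  ∑χ-≤-by-double-counting : ∀ {m n} (A : Fin m → Bool) (B : Fin n → Bool) (K : Fin m → Fin n → Bool) →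
    (∀ y → T (A y) → ∑[ z < n ] χ (K y z) ≡ 1ℤ) →
    (∀ y z → T (A y ∧ K y z) → T (B z)) →
    (∀ z → T (B z) → ∑[ y < m ] χ (A y ∧ K y z) ≤ 1ℤ) →
    ∑[ y < m ] χ (A y) ≤ ∑[ z < n ] χ (B z)
  ∑χ-≤-by-double-counting {m} {n} A B K one-image image-in-B injective = begin
    ∑[ y < m ] χ (A y)                          ≡⟨ sum-cong-≗ by-images ⟩
    ∑[ y < m ] ∑[ z < n ] χ (A y ∧ K y z)       ≡⟨ ∑-comm (λ y z → χ (A y ∧ K y z)) ⟩
    ∑[ z < n ] ∑[ y < m ] χ (A y ∧ K y z)       ≤⟨ sum-mono preimages ⟩
    ∑[ z < n ] χ (B z)                          ∎
    where
    open ℤP.≤-Reasoning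
    by-images : ∀ y → χ (A y) ≡ ∑[ z < n ] χ (A y ∧ K y z)
    by-images y with A y in ay
    ... | true  = sym (one-image y (subst T (sym ay) tt))
    ... | false = sym (sum-replicate-zero n)
    preimages : ∀ z → ∑[ y < m ] χ (A y ∧ K y z) ≤ χ (B z)
    preimages z with B z in bz
    ... | true  = injective z (subst T (sym bz) tt)
    ... | false = subst (∑[ y < m ] χ (A y ∧ K y z) ≤_) (sum-replicate-zero m)
                    (sum-mono λ y → χ-mono λ pk → subst T bz (image-in-B y z pk))

  pos-^ : ∀ m k → + (m ℕ.^ k) ≡ (+ m) ^ k
  pos-^ m zero    = refl
  pos-^ m (suc k) = trans (ℤP.pos-* m (m ℕ.^ k)) (cong (λ s → + m * s) (pos-^ m k))

  ∑χ*-bound : ∀ {n} (B : Fin n → Bool) (f : Fin n → ℤ) k c → (∀ x → T (B x) → k * f x ≤ c) →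
    k * ∑[ x < n ] (χ (B x) * f x) ≤ c * ∑[ x < n ] χ (B x)
  ∑χ*-bound {n} B f k c bound = begin
    k * ∑[ x < n ] (χ (B x) * f x)  ≡⟨ sum-scale k (λ x → χ (B x) * f x) ⟨
    ∑[ x < n ] (k * (χ (B x) * f x)) ≤⟨ sum-mono pointwise ⟩
    ∑[ x < n ] (c * χ (B x))        ≡⟨ sum-scale c (χ ∘ B) ⟩
    c * ∑[ x < n ] χ (B x)          ∎
    where
    open ℤP.≤-Reasoning
    pointwise : ∀ x → k * (χ (B x) * f x) ≤ c * χ (B x)
    pointwise x with B x in bx
    ... | true  = subst₂ _≤_ (cong (k *_) (sym (ℤP.*-identityˡ (f x)))) (sym (ℤP.*-identityʳ c))
                         (bound x (subst T (sym bx) tt))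
    ... | false = ℤP.≤-reflexive (trans (ℤP.*-zeroʳ k) (sym (ℤP.*-zeroʳ c)))

  module PolarityGraph {n : ℕ} (M : Fin n → Fin n → ℤ) (q : ℕ) (R : ℤ)
    (M-sym : ∀ x y → M x y ≡ M y x)
    (col-sum : ∀ y → ∑[ x < n ] M x y ≡ R)
    (gram : ∀ y z → ∑[ x < n ] (M x y * M x z) ≡ 1ℤ + + q * + q * δ y z)
    where

    N Q : ℤ
    N = + n
    Q = + q

    M· : (Fin n → ℤ) → Fin n → ℤ
    M· g x = ∑[ y < n ] (M x y * g y)

    M+Q· : (Fin n → ℤ) → Fin n → ℤ
    M+Q· g x = M· g x + Q * g x

    ⟨_,_⟩ : (Fin n → ℤ) → (Fin n → ℤ) → ℤ
    ⟨ f , g ⟩ = ∑[ x < n ] (f x * g x)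

    row-sum : ∀ x → ∑[ y < n ] M x y ≡ R
    row-sum x = trans (sum-cong-≗ (M-sym x)) (col-sum x)

    sum-M· : ∀ g → sum (M· g) ≡ R * sum g
    sum-M· g = begin
      ∑[ x < n ] ∑[ y < n ] (M x y * g y)   ≡⟨ ∑-comm (λ x y → M x y * g y) ⟩
      ∑[ y < n ] ∑[ x < n ] (M x y * g y)   ≡⟨ sum-cong-≗ column ⟩
      ∑[ y < n ] (R * g y)                  ≡⟨ sum-scale R g ⟩
      R * sum g                             ∎
      where
      open ≡-Reasoning
      column : ∀ y → ∑[ x < n ] (M x y * g y) ≡ R * g y
      column y = trans (sym (*-distribʳ-sum (g y) (λ x → M x y))) (cong (λ s → s * g y) (col-sum y))

    ⟨M·,M·⟩ : ∀ g → ⟨ M· g , M· g ⟩ ≡ sum g * sum g + Q * Q * ⟨ g , g ⟩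
    ⟨M·,M·⟩ g = begin
      ∑[ x < n ] (M· g x * M· g x)
        ≡⟨ sum-cong-≗ expand ⟩
      ∑[ x < n ] ∑[ y < n ] ∑[ z < n ] ((M x y * g y) * (M x z * g z))
        ≡⟨ ∑-comm (λ x y → ∑[ z < n ] ((M x y * g y) * (M x z * g z))) ⟩
      ∑[ y < n ] ∑[ x < n ] ∑[ z < n ] ((M x y * g y) * (M x z * g z))
        ≡⟨ sum-cong-≗ (λ y → ∑-comm (λ x z → (M x y * g y) * (M x z * g z))) ⟩
      ∑[ y < n ] ∑[ z < n ] ∑[ x < n ] ((M x y * g y) * (M x z * g z))
        ≡⟨ sum-cong-≗ (λ y → sum-cong-≗ (by-gram y)) ⟩
      ∑[ y < n ] ∑[ z < n ] (g y * g z + Q * Q * (g y * g z) * δ y z)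
        ≡⟨ sum-cong-≗ row ⟩
      ∑[ y < n ] (sum g * g y + Q * Q * (g y * g y))
        ≡⟨ trans (∑-distrib-+ (λ y → sum g * g y) (λ y → Q * Q * (g y * g y)))
                 (cong₂ _+_ (sum-scale (sum g) g) (sum-scale (Q * Q) (λ y → g y * g y))) ⟩
      sum g * sum g + Q * Q * ⟨ g , g ⟩
        ∎
      where
      open ≡-Reasoning
      expand : ∀ x → M· g x * M· g x ≡ ∑[ y < n ] ∑[ z < n ] ((M x y * g y) * (M x z * g z))
      expand x = trans (*-distribʳ-sum (M· g x) (λ y → M x y * g y))
                       (sum-cong-≗ λ y → *-distribˡ-sum (M x y * g y) (λ z → M x z * g z))
      by-gram : ∀ y z → ∑[ x < n ] ((M x y * g y) * (M x z * g z)) ≡ g y * g z + Q * Q * (g y * g z) * δ y z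
      by-gram y z = begin
        ∑[ x < n ] ((M x y * g y) * (M x z * g z))  ≡⟨ sum-cong-≗ (λ x → regroup (M x y) (M x z) (g y) (g z)) ⟩
        ∑[ x < n ] (g y * g z * (M x y * M x z))   ≡⟨ sum-scale (g y * g z) (λ x → M x y * M x z) ⟩
        g y * g z * ∑[ x < n ] (M x y * M x z)     ≡⟨ cong (λ s → g y * g z * s) (gram y z) ⟩
        g y * g z * (1ℤ + Q * Q * δ y z)           ≡⟨ distribute (g y) (g z) Q (δ y z) ⟩
        g y * g z + Q * Q * (g y * g z) * δ y z    ∎
        where
        regroup : ∀ a b c d → (a * c) * (b * d) ≡ c * d * (a * b)
        regroup = solve-∀
        distribute : ∀ a b Q d → a * b * (1ℤ + Q * Q * d) ≡ a * b + Q * Q * (a * b) * d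
        distribute = solve-∀
      row : ∀ y → ∑[ z < n ] (g y * g z + Q * Q * (g y * g z) * δ y z) ≡ sum g * g y + Q * Q * (g y * g y)
      row y = begin
        ∑[ z < n ] (g y * g z + Q * Q * (g y * g z) * δ y z)
          ≡⟨ ∑-distrib-+ (λ z → g y * g z) (λ z → Q * Q * (g y * g z) * δ y z) ⟩
        ∑[ z < n ] (g y * g z) + ∑[ z < n ] (Q * Q * (g y * g z) * δ y z)
          ≡⟨ cong₂ _+_ (trans (sum-scale (g y) g) (ℤP.*-comm (g y) (sum g))) (sum-δ y (λ z → Q * Q * (g y * g z))) ⟩
        sum g * g y + Q * Q * (g y * g y)
          ∎

    R*R≡N+Q*Q : ⦃ _ : ℕ.NonZero n ⦄ → R * R ≡ N + Q * Q
    R*R≡N+Q*Q = ℤP.*-cancelˡ-≡ N (R * R) (N + Q * Q) (begin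
      N * (R * R)                          ≡⟨ sym (sum-const n (R * R)) ⟩
      ∑[ x < n ] (R * R)                   ≡⟨ sum-cong-≗ (λ x → sym (cong₂ _*_ (M·1 x) (M·1 x))) ⟩
      ⟨ M· 1s , M· 1s ⟩                     ≡⟨ ⟨M·,M·⟩ 1s ⟩
      sum 1s * sum 1s + Q * Q * sum 1s     ≡⟨ cong (λ s → s * s + Q * Q * s) (sum-const n 1ℤ) ⟩
      N * 1ℤ * (N * 1ℤ) + Q * Q * (N * 1ℤ) ≡⟨ factor N Q ⟩
      N * (N + Q * Q)                      ∎)
      where
      open ≡-Reasoning
      1s : Fin n → ℤ
      1s _ = 1ℤ
      M·1 : ∀ x → M· 1s x ≡ R
      M·1 x = trans (sum-cong-≗ (λ y → ℤP.*-identityʳ (M x y))) (row-sum x)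
      factor : ∀ N Q → N * 1ℤ * (N * 1ℤ) + Q * Q * (N * 1ℤ) ≡ N * (N + Q * Q)
      factor = solve-∀

    -- (M + Q)² = J + 2Q (M + Q) since M² = J + Q², and J kills vectors with zero sum.
    ⟨M+Q·,M+Q·⟩ : ∀ g → sum g ≡ 0ℤ → ⟨ M+Q· g , M+Q· g ⟩ ≡ + 2 * Q * ⟨ g , M+Q· g ⟩
    ⟨M+Q·,M+Q·⟩ g Σg≡0 = begin
      ∑[ x < n ] (M+Q· g x * M+Q· g x)
        ≡⟨ sum-cong-≗ (λ x → split Q (M· g x) (g x)) ⟩
      ∑[ x < n ] (1ℤ * (M· g x * M· g x) + - (Q * Q) * (g x * g x) + + 2 * Q * (g x * M+Q· g x) + 0ℤ)
        ≡⟨ sum-affine 1ℤ (- (Q * Q)) (+ 2 * Q) 0ℤ (λ x → M· g x * M· g x) (λ x → g x * g x) (λ x → g x * M+Q· g x) ⟩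
      1ℤ * ⟨ M· g , M· g ⟩ + - (Q * Q) * ⟨ g , g ⟩ + + 2 * Q * ⟨ g , M+Q· g ⟩ + N * 0ℤ
        ≡⟨ cong (λ s → 1ℤ * s + - (Q * Q) * ⟨ g , g ⟩ + + 2 * Q * ⟨ g , M+Q· g ⟩ + N * 0ℤ)
                (trans (⟨M·,M·⟩ g) (cong (λ s → s * s + Q * Q * ⟨ g , g ⟩) Σg≡0)) ⟩
      1ℤ * (0ℤ * 0ℤ + Q * Q * ⟨ g , g ⟩) + - (Q * Q) * ⟨ g , g ⟩ + + 2 * Q * ⟨ g , M+Q· g ⟩ + N * 0ℤ
        ≡⟨ cancel Q N ⟨ g , g ⟩ ⟨ g , M+Q· g ⟩ ⟩
      + 2 * Q * ⟨ g , M+Q· g ⟩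
        ∎
      where
      open ≡-Reasoning
      split : ∀ Q u v → (u + Q * v) * (u + Q * v) ≡ 1ℤ * (u * u) + - (Q * Q) * (v * v) + + 2 * Q * (v * (u + Q * v)) + 0ℤ
      split = solve-∀
      cancel : ∀ Q N G H → 1ℤ * (0ℤ * 0ℤ + Q * Q * G) + - (Q * Q) * G + + 2 * Q * H + N * 0ℤ ≡ + 2 * Q * H
      cancel = solve-∀

    module _ (B : Fin n → Bool) where

      size : ℤ
      size = ∑[ x < n ] χ (B x)

      degree : Fin n → ℤ
      degree = M· (χ ∘ B)

      -- N * excess = ⟨ centred , M+Q· centred ⟩, so for q > 0 excess ≥ 0 is a Hoffman-type bound on
      -- ⟨ χ ∘ B , degree ⟩, and excess ≤ 0 forces M+Q· centred = 0.
      excess : ℤ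
      excess = Q * size * (N - size) + N * ⟨ χ ∘ B , degree ⟩ - size * size * R

      centred : Fin n → ℤ
      centred x = N * χ (B x) - size

      sum-centred : sum centred ≡ 0ℤ
      sum-centred = begin
        ∑[ x < n ] (N * χ (B x) - size)                ≡⟨ ∑-distrib-+ (λ x → N * χ (B x)) (λ _ → - size) ⟩
        ∑[ x < n ] (N * χ (B x)) + ∑[ x < n ] (- size) ≡⟨ cong₂ _+_ (sum-scale N (χ ∘ B)) (sum-const n (- size)) ⟩
        N * size + N * - size                          ≡⟨ vanish N size ⟩
        0ℤ                                             ∎
        where
        open ≡-Reasoning
        vanish : ∀ N b → N * b + N * - b ≡ 0ℤ
        vanish = solve-∀

      M·-centred : ∀ x → M· centred x ≡ N * degree x - size * R
      M·-centred x = begin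
        ∑[ y < n ] (M x y * (N * χ (B y) - size))
          ≡⟨ sum-cong-≗ (λ y → distribute (M x y) N (χ (B y)) size) ⟩
        ∑[ y < n ] (N * (M x y * χ (B y)) + - size * M x y)
          ≡⟨ ∑-distrib-+ (λ y → N * (M x y * χ (B y))) (λ y → - size * M x y) ⟩
        ∑[ y < n ] (N * (M x y * χ (B y))) + ∑[ y < n ] (- size * M x y)
          ≡⟨ cong₂ _+_ (sum-scale N (λ y → M x y * χ (B y)))
                       (trans (sum-scale (- size) (M x)) (cong (λ s → - size * s) (row-sum x))) ⟩
        N * degree x + - size * R
          ≡⟨ cong (λ s → N * degree x + s) (sym (ℤP.neg-distribˡ-* size R)) ⟩
        N * degree x - size * R
          ∎
        where
        open ≡-Reasoning
        distribute : ∀ m N c b → m * (N * c - b) ≡ N * (m * c) + - b * m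
        distribute = solve-∀

      ⟨centred,M+Q·centred⟩ : ⟨ centred , M+Q· centred ⟩ ≡ N * excess
      ⟨centred,M+Q·centred⟩ = begin
        ∑[ x < n ] (centred x * M+Q· centred x)
          ≡⟨ sum-cong-≗ pointwise ⟩
        ∑[ x < n ] (N * N * (χ (B x) * degree x) + α * χ (B x) + - (size * N) * degree x + γ)
          ≡⟨ sum-affine (N * N) α (- (size * N)) γ (λ x → χ (B x) * degree x) (χ ∘ B) degree ⟩
        N * N * ⟨ χ ∘ B , degree ⟩ + α * size + - (size * N) * sum degree + N * γ
          ≡⟨ cong (λ s → N * N * ⟨ χ ∘ B , degree ⟩ + α * size + - (size * N) * s + N * γ) (sum-M· (χ ∘ B)) ⟩
        N * N * ⟨ χ ∘ B , degree ⟩ + α * size + - (size * N) * (R * size) + N * γ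
          ≡⟨ collect N Q R size ⟨ χ ∘ B , degree ⟩ ⟩
        N * excess
          ∎
        where
        open ≡-Reasoning
        α γ : ℤ
        α = Q * N * N - N * size * R - + 2 * Q * N * size
        γ = size * size * R + Q * size * size
        expand : ∀ c → ∀ N Q R b d →
          (N * χ c - b) * ((N * d - b * R) + Q * (N * χ c - b))
            ≡ N * N * (χ c * d) + (Q * N * N - N * b * R - + 2 * Q * N * b) * χ c + - (b * N) * d + (b * b * R + Q * b * b)
        expand true  = solve-∀
        expand false = solve-∀
        pointwise : ∀ x → centred x * M+Q· centred x
                          ≡ N * N * (χ (B x) * degree x) + α * χ (B x) + - (size * N) * degree x + γ
        pointwise x = trans (cong (λ s → centred x * (s + Q * centred x)) (M·-centred x))
                            (expand (B x) N Q R size (degree x))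
        collect : ∀ N Q R b Y →
          N * N * Y + (Q * N * N - N * b * R - + 2 * Q * N * b) * b + - (b * N) * (R * b) + N * (b * b * R + Q * b * b)
            ≡ N * (Q * b * (N - b) + N * Y - b * b * R)
        collect = solve-∀

      ⟨M+Q·centred⟩²-≤0 : excess ≤ 0ℤ → ⟨ M+Q· centred , M+Q· centred ⟩ ≤ 0ℤ
      ⟨M+Q·centred⟩²-≤0 excess≤0 = begin
        ⟨ M+Q· centred , M+Q· centred ⟩      ≡⟨ ⟨M+Q·,M+Q·⟩ centred sum-centred ⟩
        + 2 * Q * ⟨ centred , M+Q· centred ⟩ ≡⟨ cong (λ s → + 2 * Q * s) ⟨centred,M+Q·centred⟩ ⟩
        + 2 * Q * (N * excess)               ≡⟨ ℤP.*-assoc (+ 2 * Q) N excess ⟨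
        + 2 * Q * N * excess                 ≤⟨ ℤP.*-monoˡ-≤-nonNeg (+ 2 * Q * N) ⦃ nonNegative 2QN-nonneg ⦄ excess≤0 ⟩
        + 2 * Q * N * 0ℤ                     ≡⟨ ℤP.*-zeroʳ (+ 2 * Q * N) ⟩
        0ℤ                                   ∎
        where
        open ℤP.≤-Reasoning
        2QN-nonneg : 0ℤ ≤ + 2 * Q * N
        2QN-nonneg = subst (0ℤ ≤_) (trans (ℤP.pos-* (2 ℕ.* q) n) (cong (λ s → s * N) (ℤP.pos-* 2 q))) (+≤+ ℕ.z≤n)

      degree-regular : excess ≤ 0ℤ → ∀ x → N * (degree x + Q * χ (B x)) ≡ size * (R + Q)
      degree-regular excess≤0 x = begin
        N * (degree x + Q * χ (B x))                               ≡⟨ rearrange N Q R size (degree x) (χ (B x)) ⟩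
        (N * degree x - size * R) + Q * centred x + size * (R + Q) ≡⟨ cong (λ s → s + Q * centred x + size * (R + Q)) (M·-centred x) ⟨
        M+Q· centred x + size * (R + Q)                            ≡⟨ cong (λ s → s + size * (R + Q)) M+Q·centred≡0 ⟩
        0ℤ + size * (R + Q)                                        ≡⟨ ℤP.+-identityˡ (size * (R + Q)) ⟩
        size * (R + Q)                                             ∎
        where
        open ≡-Reasoning
        M+Q·centred≡0 : M+Q· centred x ≡ 0ℤ
        M+Q·centred≡0 = sum-squares-≤0⇒≡0 (M+Q· centred) (⟨M+Q·centred⟩²-≤0 excess≤0) x
        rearrange : ∀ N Q R b d c → N * (d + Q * c) ≡ (N * d - b * R) + Q * (N * c - b) + b * (R + Q)
        rearrange = solve-∀

  module PlaneWithPolarity (q : ℕ) (Π : ProjectivePlane (q ℕ.^ 2)) (pl : Polarity Π) where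
    open ProjectivePlane Π
    open Polarity pl

    inc-pol-sym : ∀ x y → inc x (pol y) ≡ inc y (pol x)
    inc-pol-sym x y = trans (preserves x (pol y)) (cong (λ z → inc z (pol x)) (pol⁻-pol y))

    ∈⊥-sym : ∀ {x y} → T (inc x (pol y)) → T (inc y (pol x))
    ∈⊥-sym {x} {y} = subst T (inc-pol-sym x y)

    pol-injective : ∀ {x y} → pol x ≡ pol y → x ≡ y
    pol-injective {x} {y} eq = trans (sym (pol⁻-pol x)) (trans (cong pol⁻ eq) (pol⁻-pol y))

    polars-meet-once : ∀ x y → x ≢ y → ∑[ w < np ] χ (inc w (pol x) ∧ inc w (pol y)) ≡ 1ℤ
    polars-meet-once x y x≢y with meet (pol x) (pol y) (x≢y ∘ pol-injective)
    ... | w , w∈x⊥ , w∈y⊥ = sum-χ-unique _ w (∧-intro w∈x⊥ w∈y⊥) λ v v∈x⊥∩y⊥ →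
      let v∈x⊥ , v∈y⊥ = ∧-elim v∈x⊥∩y⊥
      in meet-unique (pol x) (pol y) v w (x≢y ∘ pol-injective) v∈x⊥ v∈y⊥ w∈x⊥ w∈y⊥

    Q : ℤ
    Q = + q

    pos-q^2 : + (q ℕ.^ 2) ≡ Q * Q
    pos-q^2 = trans (pos-^ q 2) (cong (Q *_) (ℤP.*-identityʳ Q))

    M : Point Π → Point Π → ℤ
    M x y = χ (inc x (pol y))

    M-sym : ∀ x y → M x y ≡ M y x
    M-sym x y = cong χ (inc-pol-sym x y)

    col-sum : ∀ y → ∑[ x < np ] M x y ≡ 1ℤ + Q * Q
    col-sum y = begin
      ∑[ x < np ] χ (inc x (pol y))  ≡⟨ count-as-sum (λ x → inc x (pol y)) ⟨
      + count (λ x → inc x (pol y))  ≡⟨ cong +_ (line-size (pol y)) ⟩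
      + suc (q ℕ.^ 2)                ≡⟨ cong (λ s → 1ℤ + s) pos-q^2 ⟩
      1ℤ + Q * Q                     ∎
      where open ≡-Reasoning

    gram : ∀ y z → ∑[ x < np ] (M x y * M x z) ≡ 1ℤ + Q * Q * δ y z
    gram y z with y ≟ z
    ... | yes refl = begin
      ∑[ x < np ] (M x y * M x y)  ≡⟨ sum-cong-≗ (λ x → trans (χ-∧ (inc x (pol y)) (inc x (pol y))) (cong χ (∧-idem (inc x (pol y))))) ⟩
      ∑[ x < np ] M x y            ≡⟨ col-sum y ⟩
      1ℤ + Q * Q                   ≡⟨ cong (λ s → 1ℤ + s) (ℤP.*-identityʳ (Q * Q)) ⟨
      1ℤ + Q * Q * 1ℤ              ∎
      where open ≡-Reasoning
    ... | no y≢z = begin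
      ∑[ x < np ] (M x y * M x z)                      ≡⟨ sum-cong-≗ (λ x → χ-∧ (inc x (pol y)) (inc x (pol z))) ⟩
      ∑[ x < np ] χ (inc x (pol y) ∧ inc x (pol z))    ≡⟨ polars-meet-once y z y≢z ⟩
      1ℤ                                               ≡⟨ ℤP.+-identityʳ 1ℤ ⟨
      1ℤ + 0ℤ                                          ≡⟨ cong (λ s → 1ℤ + s) (ℤP.*-zeroʳ (Q * Q)) ⟨
      1ℤ + Q * Q * 0ℤ                                  ∎
      where open ≡-Reasoning

    open PolarityGraph M q (1ℤ + Q * Q) M-sym col-sum gram public
      hiding (Q)

    instance
      np-nonZero : ℕ.NonZero np
      np-nonZero = nonZeroIndex (proj₁ quadrangle zero)

    N≡ : N ≡ Q * Q * Q * Q + Q * Q + 1ℤ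
    N≡ = begin
      N                                 ≡⟨ add-sub N (Q * Q) ⟩
      N + Q * Q - Q * Q                 ≡⟨ cong (λ s → s - Q * Q) R*R≡N+Q*Q ⟨
      (1ℤ + Q * Q) * (1ℤ + Q * Q) - Q * Q ≡⟨ expand Q ⟩
      Q * Q * Q * Q + Q * Q + 1ℤ        ∎
      where
      open ≡-Reasoning
      add-sub : ∀ a b → a ≡ a + b - b
      add-sub = solve-∀
      expand : ∀ Q → (1ℤ + Q * Q) * (1ℤ + Q * Q) - Q * Q ≡ Q * Q * Q * Q + Q * Q + 1ℤ
      expand = solve-∀

    degree-as-sum : ∀ B x → degree B x ≡ ∑[ y < np ] χ (B y ∧ inc y (pol x))
    degree-as-sum B x = sum-cong-≗ λ y →
      trans (χ-∧ (inc x (pol y)) (B y))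
            (cong χ (trans (cong (_∧ B y) (inc-pol-sym x y)) (∧-comm (inc y (pol x)) (B y))))

    absolute′ : Point Π → Bool
    absolute′ = absolute Π pl

    degree-absolute-of-absolute : ∀ x → T (absolute′ x) → degree absolute′ x ≡ 1ℤ
    degree-absolute-of-absolute x x∈x⊥ =
      trans (degree-as-sum absolute′ x) (sum-χ-unique _ x (∧-intro x∈x⊥ x∈x⊥) only-x)
      where
      only-x : ∀ v → T (absolute′ v ∧ inc v (pol x)) → v ≡ x
      only-x v v-abs-on-x⊥ with v ≟ x
      ... | yes v≡x = v≡x
      ... | no  v≢x = let v∈v⊥ , v∈x⊥ = ∧-elim v-abs-on-x⊥ in
        meet-unique (pol v) (pol x) v x (v≢x ∘ pol-injective) v∈v⊥ v∈x⊥ (∈⊥-sym v∈x⊥) x∈x⊥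

    module _ (unitary : IsUnitary q Π pl) where

      size-absolute : size absolute′ ≡ Q * Q * Q + 1ℤ
      size-absolute = begin
        size absolute′         ≡⟨ count-as-sum absolute′ ⟨
        + count absolute′      ≡⟨ cong +_ unitary ⟩
        + (q ℕ.^ 3 ℕ.+ 1)      ≡⟨ ℤP.pos-+ (q ℕ.^ 3) 1 ⟩
        + (q ℕ.^ 3) + 1ℤ       ≡⟨ cong (_+ 1ℤ) (trans (pos-^ q 3) (cube Q)) ⟩
        Q * Q * Q + 1ℤ         ∎
        where
        open ≡-Reasoning
        cube : ∀ Q → Q * (Q * (Q * 1ℤ)) ≡ Q * Q * Q
        cube = solve-∀

      -- Each absolute point is the only absolute point on its polar, so the absolute points attain equality in the Hoffman-type bound.
      excess-absolute : excess absolute′ ≡ 0ℤ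
      excess-absolute = begin
        Q * b * (N - b) + N * ⟨ χ ∘ absolute′ , degree absolute′ ⟩ - b * b * R
          ≡⟨ cong (λ Y → Q * b * (N - b) + N * Y - b * b * R) (sum-cong-≗ loops) ⟩
        Q * b * (N - b) + N * b - b * b * R
          ≡⟨ cong₂ (λ N b → Q * b * (N - b) + N * b - b * b * R) N≡ size-absolute ⟩
        Q * (Q * Q * Q + 1ℤ) * ((Q * Q * Q * Q + Q * Q + 1ℤ) - (Q * Q * Q + 1ℤ))
          + (Q * Q * Q * Q + Q * Q + 1ℤ) * (Q * Q * Q + 1ℤ) - (Q * Q * Q + 1ℤ) * (Q * Q * Q + 1ℤ) * R
          ≡⟨ vanish Q ⟩
        0ℤ
          ∎
        where
        open ≡-Reasoning
        b R : ℤ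
        b = size absolute′
        R = 1ℤ + Q * Q
        loops : ∀ x → χ (absolute′ x) * degree absolute′ x ≡ χ (absolute′ x)
        loops x with absolute′ x in ax
        ... | true  = trans (ℤP.*-identityˡ _) (degree-absolute-of-absolute x (subst T (sym ax) tt))
        ... | false = refl
        vanish : ∀ Q → Q * (Q * Q * Q + 1ℤ) * ((Q * Q * Q * Q + Q * Q + 1ℤ) - (Q * Q * Q + 1ℤ))
          + (Q * Q * Q * Q + Q * Q + 1ℤ) * (Q * Q * Q + 1ℤ) - (Q * Q * Q + 1ℤ) * (Q * Q * Q + 1ℤ) * (1ℤ + Q * Q) ≡ 0ℤ
        vanish = solve-∀

      degree-absolute : ∀ x → ¬ T (absolute′ x) → degree absolute′ x ≡ Q + 1ℤ
      degree-absolute x x∉x⊥ = ℤP.*-cancelˡ-≡ N (degree absolute′ x) (Q + 1ℤ) (begin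
        N * degree absolute′ x                             ≡⟨ cong (N *_) (ℤP.+-identityʳ _) ⟨
        N * (degree absolute′ x + 0ℤ)                      ≡⟨ cong (λ c → N * (degree absolute′ x + c)) (ℤP.*-zeroʳ Q) ⟨
        N * (degree absolute′ x + Q * 0ℤ)                  ≡⟨ cong (λ c → N * (degree absolute′ x + Q * c)) (χ-¬T x∉x⊥) ⟨
        N * (degree absolute′ x + Q * χ (absolute′ x))     ≡⟨ degree-regular absolute′ (ℤP.≤-reflexive excess-absolute) x ⟩
        size absolute′ * (1ℤ + Q * Q + Q)                  ≡⟨ cong (_* (1ℤ + Q * Q + Q)) size-absolute ⟩
        (Q * Q * Q + 1ℤ) * (1ℤ + Q * Q + Q)                ≡⟨ factor Q ⟩
        (Q * Q * Q * Q + Q * Q + 1ℤ) * (Q + 1ℤ)            ≡⟨ cong (_* (Q + 1ℤ)) N≡ ⟨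
        N * (Q + 1ℤ)                                       ∎)
        where
        open ≡-Reasoning
        factor : ∀ Q → (Q * Q * Q + 1ℤ) * (1ℤ + Q * Q + Q) ≡ (Q * Q * Q * Q + Q * Q + 1ℤ) * (Q + 1ℤ)
        factor = solve-∀

      module _ (S : Point Π → Bool) (S-nonabsolute : ∀ x → T (S x) → ¬ T (absolute′ x))
               (triangle-free : TriangleFree Π pl S) where

        common-neighbour-ordinary : ∀ {x y z} → T (S x) → T (S y) → T (inc y (pol x)) →
          T (inc z (pol x)) → T (inc z (pol y)) → ¬ T (absolute′ z) × ¬ T (S z)
        common-neighbour-ordinary {x} {y} {z} x∈S y∈S y∈x⊥ z∈x⊥ z∈y⊥ = z∉z⊥ , z∉S
          where
          x≢y : x ≢ y
          x≢y refl = S-nonabsolute x x∈S y∈x⊥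
          x≢z : x ≢ z
          x≢z refl = S-nonabsolute x x∈S z∈x⊥
          y≢z : y ≢ z
          y≢z refl = S-nonabsolute y y∈S z∈y⊥
          z∉S : ¬ T (S z)
          z∉S z∈S = triangle-free x y z x∈S y∈S z∈S
            ((x≢y , ∈⊥-sym y∈x⊥) , (y≢z , ∈⊥-sym z∈y⊥) , (x≢z , ∈⊥-sym z∈x⊥))
          z∉z⊥ : ¬ T (absolute′ z)
          z∉z⊥ z∈z⊥ = y≢z (meet-unique (pol x) (pol z) y z (x≢z ∘ pol-injective) y∈x⊥ (∈⊥-sym z∈y⊥) z∈x⊥ z∈z⊥)

        ordinary : Point Π → Point Π → Bool
        ordinary x z = inc z (pol x) ∧ not (absolute′ z) ∧ not (S z)

        polar-partition : ∀ x → 1ℤ + Q * Q ≡ degree S x + ∑[ z < np ] χ (ordinary x z) + degree absolute′ x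
        polar-partition x = begin
          1ℤ + Q * Q
            ≡⟨ col-sum x ⟨
          ∑[ z < np ] χ (inc z (pol x))
            ≡⟨ sum-cong-≗ (λ z → split (S z) (inc z (pol x)) (absolute′ z) (S-nonabsolute z)) ⟩
          ∑[ z < np ] (χ (S z ∧ inc z (pol x)) + χ (ordinary x z) + χ (absolute′ z ∧ inc z (pol x)))
            ≡⟨ ∑-distrib-+ (λ z → χ (S z ∧ inc z (pol x)) + χ (ordinary x z)) (λ z → χ (absolute′ z ∧ inc z (pol x))) ⟩
          ∑[ z < np ] (χ (S z ∧ inc z (pol x)) + χ (ordinary x z)) + ∑[ z < np ] χ (absolute′ z ∧ inc z (pol x))
            ≡⟨ cong₂ _+_ (∑-distrib-+ (λ z → χ (S z ∧ inc z (pol x))) (λ z → χ (ordinary x z)))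
                         (sym (degree-as-sum absolute′ x)) ⟩
          ∑[ z < np ] χ (S z ∧ inc z (pol x)) + ∑[ z < np ] χ (ordinary x z) + degree absolute′ x
            ≡⟨ cong (λ d → d + ∑[ z < np ] χ (ordinary x z) + degree absolute′ x) (sym (degree-as-sum S x)) ⟩
          degree S x + ∑[ z < np ] χ (ordinary x z) + degree absolute′ x
            ∎
          where
          open ≡-Reasoning
          split : ∀ s l a → (T s → ¬ T a) → χ l ≡ χ (s ∧ l) + χ (l ∧ not a ∧ not s) + χ (a ∧ l)
          split true  true  true  s⇒¬a = contradiction tt (s⇒¬a tt)
          split true  true  false _    = refl
          split true  false true  _    = refl
          split true  false false _    = refl
          split false true  true  _    = refl
          split false true  false _    = refl
          split false false true  _    = refl
          split false false false _    = refl

        degree-≤-ordinary : ∀ x → T (S x) → degree S x ≤ ∑[ z < np ] χ (ordinary x z)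
        degree-≤-ordinary x x∈S =
          subst (_≤ ∑[ z < np ] χ (ordinary x z)) (sym (degree-as-sum S x))
            (∑χ-≤-by-double-counting (λ y → S y ∧ inc y (pol x)) (ordinary x)
              (λ y z → inc z (pol x) ∧ inc z (pol y)) one-foot foot-ordinary at-most-one)
          where
          one-foot : ∀ y → T (S y ∧ inc y (pol x)) → ∑[ z < np ] χ (inc z (pol x) ∧ inc z (pol y)) ≡ 1ℤ
          one-foot y y∈S∩x⊥ = polars-meet-once x y λ { refl → S-nonabsolute x x∈S (proj₂ (∧-elim y∈S∩x⊥)) }
          foot-ordinary : ∀ y z → T ((S y ∧ inc y (pol x)) ∧ (inc z (pol x) ∧ inc z (pol y))) → T (ordinary x z)
          foot-ordinary y z h =
            let y∈S∩x⊥ , z∈x⊥∩y⊥ = ∧-elim {S y ∧ inc y (pol x)} h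
                y∈S , y∈x⊥ = ∧-elim {S y} y∈S∩x⊥
                z∈x⊥ , z∈y⊥ = ∧-elim {inc z (pol x)} z∈x⊥∩y⊥
                z∉z⊥ , z∉S = common-neighbour-ordinary x∈S y∈S y∈x⊥ z∈x⊥ z∈y⊥
            in ∧-intro z∈x⊥ (∧-intro (¬T⇒T-not z∉z⊥) (¬T⇒T-not z∉S))
          at-most-one : ∀ z → T (ordinary x z) →
            ∑[ y < np ] χ ((S y ∧ inc y (pol x)) ∧ (inc z (pol x) ∧ inc z (pol y))) ≤ 1ℤ
          at-most-one z z-ordinary = ℤP.≤-trans (sum-mono λ y → χ-mono (on-x⊥∩z⊥ y)) (ℤP.≤-reflexive (polars-meet-once x z x≢z))
            where
            x≢z : x ≢ z
            x≢z refl = T-not⇒¬T {S x} (proj₂ (∧-elim {not (absolute′ x)} (proj₂ (∧-elim {inc x (pol x)} z-ordinary)))) x∈S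
            on-x⊥∩z⊥ : ∀ y → T ((S y ∧ inc y (pol x)) ∧ (inc z (pol x) ∧ inc z (pol y))) → T (inc y (pol x) ∧ inc y (pol z))
            on-x⊥∩z⊥ y h =
              let y∈S∩x⊥ , z∈x⊥∩y⊥ = ∧-elim {S y ∧ inc y (pol x)} h
              in ∧-intro (proj₂ (∧-elim {S y} y∈S∩x⊥)) (∈⊥-sym (proj₂ (∧-elim {inc z (pol x)} z∈x⊥∩y⊥)))

        2degree-S-≤ : ∀ x → T (S x) → + 2 * degree S x ≤ Q * Q - Q
        2degree-S-≤ x x∈S = begin
          + 2 * d              ≡⟨ double d ⟩
          d + d                ≤⟨ ℤP.+-monoʳ-≤ d (degree-≤-ordinary x x∈S) ⟩
          d + o                ≡⟨ add-sub (d + o) a ⟩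
          d + o + a - a        ≡⟨ cong₂ _-_ (polar-partition x) (sym (degree-absolute x (S-nonabsolute x x∈S))) ⟨
          1ℤ + Q * Q - (Q + 1ℤ) ≡⟨ simplify Q ⟩
          Q * Q - Q            ∎
          where
          open ℤP.≤-Reasoning
          d o a : ℤ
          d = degree S x
          o = ∑[ z < np ] χ (ordinary x z)
          a = degree absolute′ x
          double : ∀ d → + 2 * d ≡ d + d
          double = solve-∀
          add-sub : ∀ u v → u ≡ u + v - v
          add-sub = solve-∀
          simplify : ∀ Q → 1ℤ + Q * Q - (Q + 1ℤ) ≡ Q * Q - Q
          simplify = solve-∀

        module _ (size-S : 2 ℕ.* count S ≡ q ℕ.^ 4 ℕ.+ q) where

          2size-S : + 2 * size S ≡ Q * Q * Q * Q + Q
          2size-S = begin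
            + 2 * size S              ≡⟨ cong (+ 2 *_) (count-as-sum S) ⟨
            + 2 * + count S           ≡⟨ ℤP.pos-* 2 (count S) ⟨
            + (2 ℕ.* count S)         ≡⟨ cong +_ size-S ⟩
            + (q ℕ.^ 4 ℕ.+ q)         ≡⟨ ℤP.pos-+ (q ℕ.^ 4) q ⟩
            + (q ℕ.^ 4) + Q           ≡⟨ cong (_+ Q) (trans (pos-^ q 4) (fourth Q)) ⟩
            Q * Q * Q * Q + Q         ∎
            where
            open ≡-Reasoning
            fourth : ∀ Q → Q * (Q * (Q * (Q * 1ℤ))) ≡ Q * Q * Q * Q
            fourth = solve-∀

          excess-S≤0 : excess S ≤ 0ℤ
          excess-S≤0 = ℤP.*-cancelˡ-≤-pos (excess S) 0ℤ (+ 4) (begin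
            + 4 * excess S
              ≡⟨ scale N Q b Y ⟩
            + 2 * N * (+ 2 * Y) + rest N (+ 2 * b)
              ≤⟨ ℤP.+-monoˡ-≤ (rest N (+ 2 * b)) (ℤP.*-monoˡ-≤-nonNeg (+ 2 * N) ⦃ nonNegative 2N-nonneg ⦄ 2Y≤) ⟩
            + 2 * N * ((Q * Q - Q) * b) + rest N (+ 2 * b)
              ≡⟨ cong (_+ rest N (+ 2 * b)) (regroup N Q b) ⟩
            N * (Q * Q - Q) * (+ 2 * b) + rest N (+ 2 * b)
              ≡⟨ cong₂ (λ N b₂ → N * (Q * Q - Q) * b₂ + rest N b₂) N≡ 2size-S ⟩
            (Q * Q * Q * Q + Q * Q + 1ℤ) * (Q * Q - Q) * (Q * Q * Q * Q + Q) + rest (Q * Q * Q * Q + Q * Q + 1ℤ) (Q * Q * Q * Q + Q)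
              ≡⟨ vanish Q ⟩
            0ℤ
              ∎)
            where
            open ℤP.≤-Reasoning
            b Y : ℤ
            b = size S
            Y = ⟨ χ ∘ S , degree S ⟩
            rest : ℤ → ℤ → ℤ
            rest N b₂ = Q * b₂ * (+ 2 * N - b₂) - b₂ * b₂ * (1ℤ + Q * Q)
            2N-nonneg : 0ℤ ≤ + 2 * N
            2N-nonneg = subst (0ℤ ≤_) (ℤP.pos-* 2 np) (+≤+ ℕ.z≤n)
            2Y≤ : + 2 * Y ≤ (Q * Q - Q) * b
            2Y≤ = ∑χ*-bound S (degree S) (+ 2) (Q * Q - Q) 2degree-S-≤
            scale : ∀ N Q b Y → + 4 * (Q * b * (N - b) + N * Y - b * b * (1ℤ + Q * Q))
                    ≡ + 2 * N * (+ 2 * Y) + (Q * (+ 2 * b) * (+ 2 * N - + 2 * b) - + 2 * b * (+ 2 * b) * (1ℤ + Q * Q))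
            scale = solve-∀
            regroup : ∀ N Q b → + 2 * N * ((Q * Q - Q) * b) ≡ N * (Q * Q - Q) * (+ 2 * b)
            regroup = solve-∀
            vanish : ∀ Q → (Q * Q * Q * Q + Q * Q + 1ℤ) * (Q * Q - Q) * (Q * Q * Q * Q + Q)
              + (Q * (Q * Q * Q * Q + Q) * (+ 2 * (Q * Q * Q * Q + Q * Q + 1ℤ) - (Q * Q * Q * Q + Q))
                 - (Q * Q * Q * Q + Q) * (Q * Q * Q * Q + Q) * (1ℤ + Q * Q)) ≡ 0ℤ
            vanish = solve-∀

          degree-S-regular : ∀ x → + 2 * (degree S x + Q * χ (S x)) ≡ Q * Q + Q
          degree-S-regular x = ℤP.*-cancelˡ-≡ N _ _ (begin
            N * (+ 2 * (degree S x + Q * χ (S x)))   ≡⟨ swap N (degree S x + Q * χ (S x)) ⟩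
            + 2 * (N * (degree S x + Q * χ (S x)))   ≡⟨ cong (+ 2 *_) (degree-regular S excess-S≤0 x) ⟩
            + 2 * (size S * (1ℤ + Q * Q + Q))        ≡⟨ ℤP.*-assoc (+ 2) (size S) _ ⟨
            + 2 * size S * (1ℤ + Q * Q + Q)          ≡⟨ cong (_* (1ℤ + Q * Q + Q)) 2size-S ⟩
            (Q * Q * Q * Q + Q) * (1ℤ + Q * Q + Q)   ≡⟨ factor Q ⟩
            (Q * Q * Q * Q + Q * Q + 1ℤ) * (Q * Q + Q) ≡⟨ cong (_* (Q * Q + Q)) N≡ ⟨
            N * (Q * Q + Q)                          ∎)
            where
            open ≡-Reasoning
            swap : ∀ N u → N * (+ 2 * u) ≡ + 2 * (N * u)
            swap = solve-∀
            factor : ∀ Q → (Q * Q * Q * Q + Q) * (1ℤ + Q * Q + Q) ≡ (Q * Q * Q * Q + Q * Q + 1ℤ) * (Q * Q + Q)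
            factor = solve-∀

          polar-count : ∀ x → + (2 ℕ.* count (λ y → S y ∧ inc y (pol x))) ≡ Q * Q + Q - + 2 * Q * χ (S x)
          polar-count x = begin
            + (2 ℕ.* count (λ y → S y ∧ inc y (pol x)))  ≡⟨ ℤP.pos-* 2 (count (λ y → S y ∧ inc y (pol x))) ⟩
            + 2 * + count (λ y → S y ∧ inc y (pol x))    ≡⟨ cong (+ 2 *_) (trans (count-as-sum (λ y → S y ∧ inc y (pol x))) (sym (degree-as-sum S x))) ⟩
            + 2 * degree S x                             ≡⟨ isolate (degree S x) Q (χ (S x)) ⟩
            + 2 * (degree S x + Q * χ (S x)) - + 2 * Q * χ (S x) ≡⟨ cong (_- + 2 * Q * χ (S x)) (degree-S-regular x) ⟩
            Q * Q + Q - + 2 * Q * χ (S x)                ∎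
            where
            open ≡-Reasoning
            isolate : ∀ d Q c → + 2 * d ≡ + 2 * (d + Q * c) - + 2 * Q * c
            isolate = solve-∀

          polar-count-inside : ∀ x → T (S x) → 2 ℕ.* count (λ y → S y ∧ inc y (pol x)) ≡ q ℕ.^ 2 ℕ.∸ q
          polar-count-inside x x∈S = ℤP.+-injective (begin
            + (2 ℕ.* count (λ y → S y ∧ inc y (pol x)))  ≡⟨ polar-count x ⟩
            Q * Q + Q - + 2 * Q * χ (S x)                ≡⟨ cong (λ c → Q * Q + Q - + 2 * Q * c) (χ-T x∈S) ⟩
            Q * Q + Q - + 2 * Q * 1ℤ                     ≡⟨ simplify Q ⟩
            Q * Q - Q                                    ≡⟨ cong (_- Q) pos-q^2 ⟨
            + (q ℕ.^ 2) - Q                              ≡⟨ ℤP.m-n≡m⊖n (q ℕ.^ 2) q ⟩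
            q ℕ.^ 2 ⊖ q                                  ≡⟨ ℤP.⊖-≥ (q≤q^2 q) ⟩
            + (q ℕ.^ 2 ℕ.∸ q)                            ∎)
            where
            open ≡-Reasoning
            simplify : ∀ Q → Q * Q + Q - + 2 * Q * 1ℤ ≡ Q * Q - Q
            simplify = solve-∀
            q≤q^2 : ∀ q → q ℕ.≤ q ℕ.^ 2
            q≤q^2 zero    = ℕ.z≤n
            q≤q^2 (suc p) = ℕP.m≤m*n (suc p) (suc p ℕ.* 1)

          polar-count-outside : ∀ x → ¬ T (S x) → 2 ℕ.* count (λ y → S y ∧ inc y (pol x)) ≡ q ℕ.^ 2 ℕ.+ q
          polar-count-outside x x∉S = ℤP.+-injective (begin
            + (2 ℕ.* count (λ y → S y ∧ inc y (pol x)))  ≡⟨ polar-count x ⟩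
            Q * Q + Q - + 2 * Q * χ (S x)                ≡⟨ cong (λ c → Q * Q + Q - + 2 * Q * c) (χ-¬T x∉S) ⟩
            Q * Q + Q - + 2 * Q * 0ℤ                     ≡⟨ simplify Q ⟩
            Q * Q + Q                                    ≡⟨ cong (_+ Q) pos-q^2 ⟨
            + (q ℕ.^ 2) + Q                              ≡⟨ ℤP.pos-+ (q ℕ.^ 2) q ⟨
            + (q ℕ.^ 2 ℕ.+ q)                            ∎)
            where
            open ≡-Reasoning
            simplify : ∀ Q → Q * Q + Q - + 2 * Q * 0ℤ ≡ Q * Q + Q
            simplify = solve-∀

open import Data.Nat using (_+_; _*_; _∸_; _^_)

lemma2 : (q : ℕ) (Π : ProjectivePlane (q ^ 2)) (⊥ : Polarity Π) →
    IsUnitary q Π ⊥ →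
    (S : Point Π → Bool) →
    (∀ x → T (S x) → ¬ T (absolute Π ⊥ x)) →
    TriangleFree Π ⊥ S →
    2 * count S ≡ q ^ 4 + q →
    ∀ x →
      (T (S x) → 2 * count (λ y → S y ∧ ProjectivePlane.inc Π y (Polarity.pol ⊥ x)) ≡ q ^ 2 ∸ q) ×
      (¬ T (S x) → 2 * count (λ y → S y ∧ ProjectivePlane.inc Π y (Polarity.pol ⊥ x)) ≡ q ^ 2 + q)
lemma2 q Π ⊥ unitary S S-nonabsolute triangle-free size-S x =
    polar-count-inside unitary S S-nonabsolute triangle-free size-S x
  , polar-count-outside unitary S S-nonabsolute triangle-free size-S x
  where open PlaneWithPolarity q Π ⊥ using (polar-count-inside; polar-count-outside)
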